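{- Let $\succ$ be a complete strict social rule on $X$, and let $z\in X$ be a local optimum for some objects scheme. Then the score of $z$, i.e. the number of social outcomes $x$ with $z\succ x$, is at least $\sum_{j=1}^{n}(m_j-1)$.
   Context: Fix $n\ge1$ and positive integers $m_1,\dots,m_n$; social outcomes are $n$-tuples $x$ with $0\le x_i<m_i$, forming $X$. A complete strict social rule $\succ$ on $X$: for distinct $x,y$ exactly one of $x\succ y$, $y\succ x$ (not necessarily transitive). An object is a nonempty $I\subseteq\{1,\dots,n\}$; an objects scheme is a finite set $A$ of objects with union $\{1,\dots,n\}$. $\Phi(x,I)=\{y: y\succ x,\ y_k=x_k\ \forall k\notin I\}$; $x$ is a local optimum for $A$ if $\Phi(x,I)=\emptyset$ for all $I\in A$. -}

module Defs where

open import Data.Nat using (ℕ; zero; suc; _+_; _∸_)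
open import Data.Fin using (Fin; zero; suc)
open import Data.Fin.Subset using (Subset; _∈_; _∉_; Nonempty)
open import Data.List using (List; []; _∷_; map; concatMap; length; filter)
open import Data.List.Membership.Propositional using () renaming (_∈_ to _∈ₗ_)
open import Data.Product using (_×_; ∃; ∃-syntax; Σ)
open import Data.Sum using (_⊎_)
open import Data.Empty using (⊥)
open import Relation.Nullary using (¬_; Dec)
open import Relation.Binary.PropositionalEquality using (_≡_)
open import Data.List using (allFin)

Outcome : (n : ℕ) → (Fin n → ℕ) → Set
Outcome n m = (i : Fin n) → Fin (m i)

-- Explicit enumeration of all outcomes (each exactly once).
allOutcomes : (n : ℕ) → (m : Fin n → ℕ) → List (Outcome n m)
allOutcomes zero m = (λ ()) ∷ []
allOutcomes (suc n) m =
  concatMap (λ a → map (λ x → cons a x) (allOutcomes n (λ i → m (suc i)))) (allFin (m zero))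
  where
  cons : Fin (m zero) → Outcome n (λ i → m (suc i)) → Outcome (suc n) m
  cons a x zero = a
  cons a x (suc i) = x i

record CompleteStrict {A : Set} (_≻_ : A → A → Set) : Set where
  field
    complete   : ∀ x y → ¬ (x ≡ y) → (x ≻ y) ⊎ (y ≻ x)
    asymmetric : ∀ x y → x ≻ y → ¬ (y ≻ x)
    irreflexive : ∀ x → ¬ (x ≻ x)

Object : ℕ → Set
Object n = Σ (Subset n) Nonempty

IsObjectsScheme : {n : ℕ} → List (Object n) → Set
IsObjectsScheme {n} A = ∀ (k : Fin n) → ∃[ I ] (I ∈ₗ A × k ∈ Data.Product.proj₁ I)

InΦ : {n : ℕ} {m : Fin n → ℕ} (_≻_ : Outcome n m → Outcome n m → Set) →
      Outcome n m → Subset n → Outcome n m → Set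
InΦ _≻_ x I y = (y ≻ x) × (∀ k → k ∉ I → y k ≡ x k)

IsLocalOptimum : {n : ℕ} {m : Fin n → ℕ} (_≻_ : Outcome n m → Outcome n m → Set) →
                 List (Object n) → Outcome n m → Set
IsLocalOptimum _≻_ A x = ∀ I → I ∈ₗ A → ∀ y → ¬ InΦ _≻_ x (Data.Product.proj₁ I) y

score : {n : ℕ} {m : Fin n → ℕ} (_≻_ : Outcome n m → Outcome n m → Set) →
        (∀ x y → Dec (x ≻ y)) → Outcome n m → ℕ
score {n} {m} _≻_ dec z = length (filter (λ x → dec z x) (allOutcomes n m))

sumPred : (n : ℕ) → (Fin n → ℕ) → ℕ
sumPred zero m = 0
sumPred (suc n) m = (m zero ∸ 1) + sumPred n (λ i → m (suc i))

-- Let y differ from z in exactly one coordinate j, and let I be an object containing j.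
-- If y ≻ z then y ∈ Φ(z, I), contradicting local optimality; so completeness gives z ≻ y.
-- Coordinate j admits m j − 1 such deviations, and deviations at different
-- coordinates are distinct outcomes; hence score z ≥ ∑ⱼ (m j − 1).
module Submission where

open import Defs
open import Data.Nat using (ℕ; _≤_; zero; suc; _+_; _∸_; z≤n; s≤s)
open import Data.Nat.Properties using (+-mono-≤; +-monoʳ-≤; +-comm; module ≤-Reasoning)
open import Data.Nat.ListAction using (sum)
open import Data.Fin using (Fin; zero; suc)
open import Data.Fin.Properties using (suc-injective)
open import Data.Fin.Subset using (_∈_)
open import Data.List using (List; []; _∷_; map; concatMap; length; filter; allFin; _++_; tabulate)
open import Data.List.Properties using (filter-++; length-++; map-tabulate; map-cong)
open import Data.List.Relation.Unary.Any as Any using (Any; here; there)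
open import Data.List.Relation.Unary.Any.Properties using (map⁺; ++⁺ˡ; ++⁺ʳ)
open import Data.List.Membership.Propositional using () renaming (_∈_ to _∈ₗ_)
open import Data.List.Membership.Propositional.Properties using (∈-allFin)
open import Data.Product using (Σ-syntax; ∃-syntax; _×_; _,_; proj₁)
open import Data.Sum using (inj₁; inj₂)
open import Data.Empty using (⊥-elim)
open import Function using (_∘_)
open import Level using (0ℓ)
open import Relation.Nullary using (¬_; Dec; yes; no; contradiction)
open import Relation.Unary using (Pred; Decidable; _⊆_)
open import Relation.Binary.PropositionalEquality
  using (_≡_; _≢_; refl; sym; trans; cong; subst)

module _ {A : Set} {P : Pred A 0ℓ} (P? : Decidable P) where

  count : List A → ℕ
  count = length ∘ filter P?

  count-++ : ∀ xs ys → count (xs ++ ys) ≡ count xs + count ys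
  count-++ xs ys = trans (cong length (filter-++ P? xs ys)) (length-++ (filter P? xs))

  count-concatMap : ∀ {B : Set} (f : B → List A) bs →
                    count (concatMap f bs) ≡ sum (map (count ∘ f) bs)
  count-concatMap f []       = refl
  count-concatMap f (b ∷ bs) =
    trans (count-++ (f b) (concatMap f bs)) (cong (count (f b) +_) (count-concatMap f bs))

  1≤count : ∀ {Q : Pred A 0ℓ} {xs} → Q ⊆ P → Any Q xs → 1 ≤ count xs
  1≤count {xs = x ∷ _} Q⊆P q with P? x
  ... | yes _ = s≤s z≤n
  1≤count Q⊆P (here qx)   | no ¬px = contradiction (Q⊆P qx) ¬px
  1≤count Q⊆P (there qxs) | no _   = 1≤count Q⊆P qxs

count-map : ∀ {A B : Set} {P : Pred B 0ℓ} (P? : Decidable P) (f : A → B) xs →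
            count P? (map f xs) ≡ count (P? ∘ f) xs
count-map P? f []       = refl
count-map P? f (x ∷ xs) with P? (f x)
... | yes _ = cong suc (count-map P? f xs)
... | no _  = count-map P? f xs

∈-concatMap⁺ : ∀ {A B : Set} {Q : Pred B 0ℓ} (f : A → List B) {a as} →
               a ∈ₗ as → Any Q (f a) → Any Q (concatMap f as)
∈-concatMap⁺ f {as = b ∷ as} (here refl) q = ++⁺ˡ q
∈-concatMap⁺ f {as = b ∷ as} (there a∈) q = ++⁺ʳ (f b) (∈-concatMap⁺ f a∈ q)

k≤sum-tabulate : ∀ k (c : Fin k → ℕ) → (∀ a → 1 ≤ c a) → k ≤ sum (tabulate c)
k≤sum-tabulate zero    c 1≤c = z≤n
k≤sum-tabulate (suc k) c 1≤c = +-mono-≤ (1≤c zero) (k≤sum-tabulate k (c ∘ suc) (1≤c ∘ suc))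

pred+≤sum-tabulate : ∀ k (c : Fin k → ℕ) i → (∀ a → a ≢ i → 1 ≤ c a) →
                     (k ∸ 1) + c i ≤ sum (tabulate c)
pred+≤sum-tabulate (suc k) c zero 1≤c = begin
  k + c zero                ≡⟨ +-comm k (c zero) ⟩
  c zero + k                ≤⟨ +-monoʳ-≤ (c zero) (k≤sum-tabulate k (c ∘ suc) (λ a → 1≤c (suc a) λ ())) ⟩
  c zero + sum (tabulate (c ∘ suc)) ∎
  where open ≤-Reasoning
pred+≤sum-tabulate (suc (suc k)) c (suc i) 1≤c =
  +-mono-≤ (1≤c zero λ ()) (pred+≤sum-tabulate (suc k) (c ∘ suc) i λ a a≢i → 1≤c (suc a) (a≢i ∘ suc-injective))

_≐_ : ∀ {n m} → Outcome n m → Outcome n m → Set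
x ≐ y = ∀ i → x i ≡ y i

module _ {n : ℕ} {m : Fin (suc n) → ℕ} where

  tailₒ : Outcome (suc n) m → Outcome n (m ∘ suc)
  tailₒ x = x ∘ suc

  record IsPrepend (g : Fin (m zero) → Outcome n (m ∘ suc) → Outcome (suc n) m) : Set where
    field
      head-prepend : ∀ a x → g a x zero ≡ a
      tail-prepend : ∀ a x → tailₒ (g a x) ≐ x

-- The prepending function of allOutcomes is local to its where-block; it can only be
-- reached through the defining equation, up to the two laws of IsPrepend.
allOutcomes-suc : ∀ n (m : Fin (suc n) → ℕ) →
  Σ[ g ∈ (Fin (m zero) → Outcome n (m ∘ suc) → Outcome (suc n) m) ]
    IsPrepend g × allOutcomes (suc n) m ≡ concatMap (λ a → map (g a) (allOutcomes n (m ∘ suc))) (allFin (m zero))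
allOutcomes-suc n m = _ , record { head-prepend = λ _ _ → refl ; tail-prepend = λ _ _ _ → refl } , refl

allOutcomes-complete : ∀ n m (x : Outcome n m) → Any (_≐ x) (allOutcomes n m)
allOutcomes-complete zero    m x = here λ ()
allOutcomes-complete (suc n) m x with allOutcomes-suc n m
... | g , prep , eq = subst (Any (_≐ x)) (sym eq)
  (∈-concatMap⁺ _ (∈-allFin (x zero)) (map⁺ (Any.map g≐x (allOutcomes-complete n (m ∘ suc) (tailₒ x)))))
  where
  open IsPrepend prep
  g≐x : ∀ {y} → y ≐ tailₒ x → g (x zero) y ≐ x
  g≐x y≐x zero    = head-prepend (x zero) _
  g≐x y≐x (suc i) = trans (tail-prepend (x zero) _ i) (y≐x i)

Deviation : ∀ {n m} → Outcome n m → Outcome n m → Set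
Deviation z y = ∃[ j ] (y j ≢ z j × ∀ k → k ≢ j → y k ≡ z k)

module _ {n : ℕ} {m : Fin (suc n) → ℕ} {g : Fin (m zero) → Outcome n (m ∘ suc) → Outcome (suc n) m}
         (prep : IsPrepend g) (z : Outcome (suc n) m) where
  open IsPrepend prep

  deviation-head : ∀ {a y} → a ≢ z zero → y ≐ tailₒ z → Deviation z (g a y)
  deviation-head {a} {y} a≢z y≐z = zero , a≢z ∘ trans (sym (head-prepend a y)) , agree
    where
    agree : ∀ k → k ≢ zero → g a y k ≡ z k
    agree zero    k≢0 = contradiction refl k≢0
    agree (suc k) _   = trans (tail-prepend a y k) (y≐z k)

  deviation-tail : ∀ {y} → Deviation (tailₒ z) y → Deviation z (g (z zero) y)
  deviation-tail {y} (j , y≢z , agree) =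
    suc j , y≢z ∘ trans (sym (tail-prepend (z zero) y j)) , agree′
    where
    agree′ : ∀ k → k ≢ suc j → g (z zero) y k ≡ z k
    agree′ zero    _      = head-prepend (z zero) y
    agree′ (suc k) k≢sucj = trans (tail-prepend (z zero) y k) (agree k (k≢sucj ∘ cong suc))

sumPred≤count : ∀ n m {P : Pred (Outcome n m) 0ℓ} (P? : Decidable P) (z : Outcome n m) →
                (∀ y → Deviation z y → P y) → sumPred n m ≤ count P? (allOutcomes n m)
sumPred≤count zero    m P? z devs = z≤n
sumPred≤count (suc n) m P? z devs with allOutcomes-suc n m
... | g , prep , eq = begin
  (m zero ∸ 1) + sumPred n (m ∘ suc)       ≤⟨ +-monoʳ-≤ (m zero ∸ 1) tail-bound ⟩
  (m zero ∸ 1) + c (z zero)                ≤⟨ pred+≤sum-tabulate (m zero) c (z zero) head-bound ⟩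
  sum (tabulate c)                         ≡⟨ split ⟨
  count P? (allOutcomes (suc n) m)         ∎
  where
  open ≤-Reasoning
  L = allOutcomes n (m ∘ suc)

  c : Fin (m zero) → ℕ
  c a = count (P? ∘ g a) L

  tail-bound : sumPred n (m ∘ suc) ≤ c (z zero)
  tail-bound = sumPred≤count n (m ∘ suc) (P? ∘ g (z zero)) (tailₒ z) (λ _ → devs _ ∘ deviation-tail prep z)

  head-bound : ∀ a → a ≢ z zero → 1 ≤ c a
  head-bound a a≢z = 1≤count (P? ∘ g a) (devs _ ∘ deviation-head prep z a≢z) (allOutcomes-complete n (m ∘ suc) (tailₒ z))

  split : count P? (allOutcomes (suc n) m) ≡ sum (tabulate c)
  split = begin-equality
    count P? (allOutcomes (suc n) m)                              ≡⟨ cong (count P?) eq ⟩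
    count P? (concatMap (λ a → map (g a) L) (allFin (m zero)))    ≡⟨ count-concatMap P? _ (allFin (m zero)) ⟩
    sum (map (λ a → count P? (map (g a) L)) (allFin (m zero)))    ≡⟨ cong sum (map-cong (λ a → count-map P? (g a) L) (allFin (m zero))) ⟩
    sum (map c (allFin (m zero)))                                 ≡⟨ cong sum (map-tabulate (λ a → a) c) ⟩
    sum (tabulate c)                                              ∎

localOptimum-beats-deviations :
  ∀ {n m} {_≻_ : Outcome n m → Outcome n m → Set} {A : List (Object n)} {z y} →
  CompleteStrict _≻_ → IsObjectsScheme A → IsLocalOptimum _≻_ A z → Deviation z y → z ≻ y
localOptimum-beats-deviations {z = z} {y} cs scheme optimal (j , y≢z , agree)
  with scheme j | CompleteStrict.complete cs z y (y≢z ∘ sym ∘ cong (λ x → x j))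
... | _ , _   , _   | inj₁ z≻y = z≻y
... | I , I∈A , j∈I | inj₂ y≻z = ⊥-elim (optimal I I∈A y (y≻z , unchanged-outside))
  where
  unchanged-outside : ∀ k → ¬ k ∈ proj₁ I → y k ≡ z k
  unchanged-outside k k∉I = agree k λ k≡j → k∉I (subst (_∈ proj₁ I) (sym k≡j) j∈I)

mainTheorem11 : (n : ℕ) → 1 ≤ n → (m : Fin n → ℕ) → (∀ i → 1 ≤ m i) →
                (_≻_ : Outcome n m → Outcome n m → Set) →
                (dec : ∀ x y → Dec (x ≻ y)) →
                CompleteStrict _≻_ →
                (A : List (Object n)) → IsObjectsScheme A →
                (z : Outcome n m) → IsLocalOptimum _≻_ A z →
                sumPred n m ≤ score _≻_ dec z
mainTheorem11 n _ m _ _≻_ dec cs A scheme z optimal =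
  sumPred≤count n m (dec z) z (λ _ → localOptimum-beats-deviations cs scheme optimal)
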